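{- Every 2-sparse graph $G$ of maximum degree $\Delta\geq 3$ is $(\Delta+1)$-total-colourable.
   Context: Graphs are finite and simple. A graph is 2-sparse if every edge is incident to at least one vertex of degree at most 2. An element of $G$ is a vertex or an edge; two elements are adjacent if they are adjacent vertices, edges sharing an endpoint, or a vertex and an edge incident to it. A $k$-total-colouring assigns colours from $\{1,\dots,k\}$ to all elements so that adjacent elements receive distinct colours. -}

module Defs where

open import Data.Nat using (ℕ; _≤_; suc)
open import Data.Bool using (Bool; true; false)
open import Data.Fin using (Fin)
open import Data.List using (List; length; filter)
open import Data.List using () renaming (allFin to allFinL)
open import Data.Product using (Σ; _×_; ∃)
open import Relation.Binary.PropositionalEquality using (_≡_; _≢_)
open import Relation.Nullary using (¬_)
open import Data.Bool using (T)
open import Data.Sum using (_⊎_)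
open import Relation.Nullary.Decidable using (T?)

record Graph (n : ℕ) : Set where
  field
    adj   : Fin n → Fin n → Bool
    sym   : ∀ u v → adj u v ≡ adj v u
    irrefl : ∀ v → adj v v ≡ false
open Graph public

Adj : ∀ {n} → Graph n → Fin n → Fin n → Set
Adj G u v = T (adj G u v)

degree : ∀ {n} → Graph n → Fin n → ℕ
degree {n} G v = length (filter (λ u → T? (adj G v u)) (allFinL n))

MaxDegree : ∀ {n} → Graph n → ℕ → Set
MaxDegree {n} G Δ = (∀ v → degree G v ≤ Δ) × ∃ λ v → degree G v ≡ Δ

TwoSparse : ∀ {n} → Graph n → Set
TwoSparse G = ∀ u v → Adj G u v → (degree G u ≤ 2) ⊎ (degree G v ≤ 2)

record TotalColouring {n} (G : Graph n) (k : ℕ) : Set where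
  field
    vcol : Fin n → Fin k
    ecol : (u v : Fin n) → Adj G u v → Fin k
    ecol-sym : ∀ u v (p : Adj G u v) (q : Adj G v u) → ecol u v p ≡ ecol v u q
    vv : ∀ u v → Adj G u v → vcol u ≢ vcol v
    -- an edge and its endpoints get distinct colours
    -- (endpoint v is covered via ecol-sym applied to the pair v u)
    ve : ∀ u v (p : Adj G u v) → ecol u v p ≢ vcol u
    ee : ∀ u v w (p : Adj G u v) (q : Adj G u w) → v ≢ w → ecol u v p ≢ ecol u w q

TotalColourable : ∀ {n} → Graph n → ℕ → Set
TotalColourable G k = TotalColouring G k

-- Call a vertex Big if its degree is at least 3.  By 2-sparseness Big vertices
-- are pairwise non-adjacent, and every other vertex has degree at most 2.  We
-- build a total colouring with colours 0 … Δ in which every Big vertex gets 0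
-- (an "anchored" colouring), by induction on the number of edges:
--   * if some edge joins two non-Big vertices u, v, colour G − uv and re-insert
--     uv, recolouring u, v and possibly the edge at u (InsertSmallEdge);
--   * otherwise G is bipartite between Big and non-Big vertices; a Δ-edge-
--     colouring (König's theorem in this special case, via Kempe chains)
--     shifted to the colours 1 … Δ, colour 0 on Big vertices and a free colour
--     on each non-Big vertex give the colouring.
module Submission where

open import Data.Nat using (ℕ; zero; suc; _+_; _≤_; _<_; _≤′_; ≤′-reflexive; ≤′-step; z≤n; s≤s)
open import Data.Nat.Properties
  using (<⇒≱; _≤?_; ≰⇒>; ≤-trans; ≤-pred; ≤⇒≤′; m≤n⇒m≤1+n; +-mono-≤; +-mono-<-≤; +-mono-≤-<)
open import Data.Nat.ListAction using (sum)
open import Data.Nat.Induction using (<-wellFounded)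
open import Induction.WellFounded using (module All)
import Relation.Binary.Construct.On as On
open import Level using (0ℓ)
open import Data.Bool using (Bool; true; false; T; not; if_then_else_)
import Data.Bool.Properties as Bool
open import Data.Maybe using (Maybe; just; nothing; _>>=_)
open import Data.Maybe.Properties using (just-injective; ≡-dec)
open import Data.Fin.Permutation.Components using (transpose; transpose-inverse)
open import Data.Unit using (⊤; tt)
open import Data.Empty using (⊥-elim)
open import Data.Fin using (Fin; zero; suc; toℕ; fromℕ<)
open import Data.Vec.Functional using (updateAt)
open import Data.Vec.Functional.Properties using (updateAt-updates; updateAt-minimal)
open import Data.Fin.Properties
  using (_≟_; any?; suc-injective; injective⇒≤; toℕ<n; toℕ-injective; toℕ-fromℕ<)
open import Data.List using (List; []; _∷_; _++_; length; filter; map)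
open import Data.List.Properties using (length-++; length-map)
open import Data.List using () renaming (allFin to allFinL)
open import Data.List.Membership.Propositional using (_∈_; _∉_)
import Data.List.Membership.DecPropositional as DecMembership
open import Data.List.Membership.Propositional.Properties
  using (∈-filter⁺; ∈-allFin; ∈-map⁺; ∈-++⁺ˡ; ∈-++⁺ʳ)
open import Data.List.Membership.Setoid.Properties using (index-injective)
open import Data.List.Relation.Unary.Any using (here; there; index)
open import Data.Product using (∃; _,_; _×_; proj₁; proj₂)
open import Data.Sum using (_⊎_; inj₁; inj₂)
open import Relation.Nullary using (¬_; Dec; does; ¬?; yes; no; contradiction)
open import Relation.Nullary.Decidable using (T?; decidable-stable; dec-true; dec-false; _×-dec_; _⊎-dec_)
open import Relation.Binary.PropositionalEquality as ≡ using (_≡_; _≢_; refl; subst; setoid)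
open ≡.≡-Reasoning

open import Defs

neighbours : ∀ {n} → Graph n → Fin n → List (Fin n)
neighbours {n} G x = filter (λ y → T? (adj G x y)) (allFinL n)

∈-neighbours : ∀ {n} (G : Graph n) {x y} → Adj G x y → y ∈ neighbours G x
∈-neighbours G {x} {y} xy = ∈-filter⁺ (λ z → T? (adj G x z)) (∈-allFin y) xy

at-most-one : ∀ {A : Set} {xs : List A} {y z : A} → length xs ≤ 1 → y ∈ xs → z ∈ xs → y ≡ z
at-most-one {xs = _ ∷ []} _ (here refl) (here refl) = refl
at-most-one {xs = _ ∷ []} _ (there ()) _
at-most-one {xs = _ ∷ []} _ _ (there ())
at-most-one {xs = _ ∷ _ ∷ _} (s≤s ()) _ _

-- A colour outside a list of fewer than k colours: otherwise the positions
-- of the k colours in the list would inject Fin k into a smaller Fin.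
module _ {k : ℕ} where
  open DecMembership (_≟_ {k}) using (_∈?_)

  fresh : (xs : List (Fin k)) → length xs < k → ∃ λ γ → γ ∉ xs
  fresh xs short with any? (λ γ → ¬? (γ ∈? xs))
  ... | yes found = found
  ... | no none = contradiction (injective⇒≤ position-injective) (<⇒≱ short)
    where
      listed : ∀ γ → γ ∈ xs
      listed γ = decidable-stable (γ ∈? xs) (λ γ∉xs → none (γ , γ∉xs))
      position-injective : ∀ {γ δ} → index (listed γ) ≡ index (listed δ) → γ ≡ δ
      position-injective = index-injective (setoid (Fin k)) (listed _) (listed _)

three-avoiding : ∀ {k} → 3 < k → (a b c : Fin k) → ∃ λ γ → γ ≢ a × γ ≢ b × γ ≢ c
three-avoiding {k} 3<k a b c with fresh (a ∷ b ∷ c ∷ []) 3<k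
... | γ , γ∉ = γ , (λ e → γ∉ (here e)) , (λ e → γ∉ (there (here e)))
                 , (λ e → γ∉ (there (there (here e))))

true-or-false : (b : Bool) → b ≡ true ⊎ b ≡ false
true-or-false true  = inj₁ refl
true-or-false false = inj₂ refl

Adj-sym : ∀ {n} (G : Graph n) {x y} → Adj G x y → Adj G y x
Adj-sym G {x} {y} = subst T (Graph.sym G x y)

Adj⇒≢ : ∀ {n} (G : Graph n) {x y} → Adj G x y → x ≢ y
Adj⇒≢ G {x} xx refl = subst T (Graph.irrefl G x) xx

fresh-at : ∀ {n k} (G : Graph n) x (f : Fin n → Fin k) (extra : List (Fin k)) →
           length extra + degree G x < k →
           ∃ λ γ → γ ∉ extra × (∀ y → Adj G x y → f y ≢ γ)
fresh-at {k = k} G x f extra short with fresh (extra ++ map f (neighbours G x)) short′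
  where
    short′ : length (extra ++ map f (neighbours G x)) < k
    short′ = subst (_< k) (≡.sym (begin
      length (extra ++ map f (neighbours G x))        ≡⟨ length-++ extra ⟩
      length extra + length (map f (neighbours G x))  ≡⟨ ≡.cong (length extra +_) (length-map f (neighbours G x)) ⟩
      length extra + degree G x                       ∎)) short
... | γ , γ∉ = γ , (λ γ∈ → γ∉ (∈-++⁺ˡ γ∈)) ,
               (λ y xy e → γ∉ (∈-++⁺ʳ extra (subst (_∈ _) e (∈-map⁺ f (∈-neighbours G xy)))))

missing-colour : ∀ {n k} (G : Graph n) x (f : Fin n → Fin k) → degree G x < k →
                 ∃ λ γ → ∀ y → Adj G x y → f y ≢ γ
missing-colour G x f short with fresh-at G x f [] short
... | γ , _ , misses = γ , misses

module _ {A : Set} (p q : A → Bool) (p⇒q : ∀ x → T (p x) → T (q x)) where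
  private
    count : (A → Bool) → List A → ℕ
    count r xs = length (filter (λ x → T? (r x)) xs)

  count-mono : (xs : List A) → count p xs ≤ count q xs
  count-mono [] = z≤n
  count-mono (x ∷ xs) with p x in px | q x in qx
  ... | true  | true  = s≤s (count-mono xs)
  ... | false | true  = m≤n⇒m≤1+n (count-mono xs)
  ... | false | false = count-mono xs
  ... | true  | false = ⊥-elim (subst T qx (p⇒q x (subst T (≡.sym px) tt)))

  count-strict : (xs : List A) {x : A} → x ∈ xs → T (q x) → ¬ T (p x) → count p xs < count q xs
  count-strict (y ∷ xs) x∈ qx ¬px with p y in py | q y in qy | x∈
  ... | true  | false | _ = ⊥-elim (subst T qy (p⇒q y (subst T (≡.sym py) tt)))
  ... | true  | true  | here refl = contradiction (subst T (≡.sym py) tt) ¬px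
  ... | true  | true  | there x∈xs = s≤s (count-strict xs x∈xs qx ¬px)
  ... | false | true  | _ = s≤s (count-mono xs)
  ... | false | false | here refl = ⊥-elim (subst T qy qx)
  ... | false | false | there x∈xs = count-strict xs x∈xs qx ¬px

module _ {A : Set} (f g : A → ℕ) (f≤g : ∀ x → f x ≤ g x) where
  sum-mono : (xs : List A) → sum (map f xs) ≤ sum (map g xs)
  sum-mono [] = z≤n
  sum-mono (x ∷ xs) = +-mono-≤ (f≤g x) (sum-mono xs)

  sum-strict : (xs : List A) {x : A} → x ∈ xs → f x < g x → sum (map f xs) < sum (map g xs)
  sum-strict (y ∷ xs) (here refl) fy<gy = +-mono-<-≤ fy<gy (sum-mono xs)
  sum-strict (y ∷ xs) (there x∈xs) fx<gx = +-mono-≤-< (f≤g y) (sum-strict xs x∈xs fx<gx)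

IsPair : ∀ {n} (u v x y : Fin n) → Set
IsPair u v x y = (x ≡ u × y ≡ v) ⊎ (x ≡ v × y ≡ u)

pair? : ∀ {n} (u v x y : Fin n) → Dec (IsPair u v x y)
pair? u v x y = ((x ≟ u) ×-dec (y ≟ v)) ⊎-dec ((x ≟ v) ×-dec (y ≟ u))

pair-swap : ∀ {n} {u v x y : Fin n} → IsPair u v x y → IsPair u v y x
pair-swap (inj₁ (x≡u , y≡v)) = inj₂ (y≡v , x≡u)
pair-swap (inj₂ (x≡v , y≡u)) = inj₁ (y≡u , x≡v)

pair-flip : ∀ {n} {u v x y : Fin n} → IsPair u v x y → IsPair v u x y
pair-flip (inj₁ p) = inj₂ p
pair-flip (inj₂ p) = inj₁ p

pair-unique : ∀ {n} {u v x y z : Fin n} → IsPair u v x y → IsPair u v x z → y ≡ z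
pair-unique (inj₁ (_ , y≡v)) (inj₁ (_ , z≡v)) = ≡.trans y≡v (≡.sym z≡v)
pair-unique (inj₂ (_ , y≡u)) (inj₂ (_ , z≡u)) = ≡.trans y≡u (≡.sym z≡u)
pair-unique (inj₁ (x≡u , y≡v)) (inj₂ (x≡v , z≡u)) =
  ≡.trans y≡v (≡.trans (≡.sym x≡v) (≡.trans x≡u (≡.sym z≡u)))
pair-unique (inj₂ (x≡v , y≡u)) (inj₁ (x≡u , z≡v)) =
  ≡.trans y≡u (≡.trans (≡.sym x≡u) (≡.trans x≡v (≡.sym z≡v)))

overwrite : ∀ {n} {A : Set} (u v : Fin n) → A → (Fin n → Fin n → A) → Fin n → Fin n → A
overwrite u v p f x y with pair? u v x y
... | yes _ = p
... | no  _ = f x y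

overwrite-on : ∀ {n} {A : Set} {u v : Fin n} {p : A} {f x y} →
               IsPair u v x y → overwrite u v p f x y ≡ p
overwrite-on {u = u} {v} {x = x} {y} xy with pair? u v x y
... | yes _  = refl
... | no ¬xy = contradiction xy ¬xy

overwrite-off : ∀ {n} {A : Set} {u v : Fin n} {p : A} {f x y} →
                ¬ IsPair u v x y → overwrite u v p f x y ≡ f x y
overwrite-off {u = u} {v} {x = x} {y} ¬xy with pair? u v x y
... | yes xy = contradiction xy ¬xy
... | no _   = refl

overwrite-sym : ∀ {n} {A : Set} {u v : Fin n} {p : A} {f} (R : Fin n → Fin n → Set) →
                (∀ {x y} → R x y → ¬ IsPair u v x y → f x y ≡ f y x) →
                ∀ {x y} → R x y → overwrite u v p f x y ≡ overwrite u v p f y x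
overwrite-sym {u = u} {v} R f-sym {x} {y} xy with pair? u v x y | pair? u v y x
... | yes _  | yes _  = refl
... | yes p  | no ¬p  = contradiction (pair-swap p) ¬p
... | no ¬p  | yes p  = contradiction (pair-swap p) ¬p
... | no ¬p  | no _   = f-sym xy ¬p

removeEdge : ∀ {n} → Graph n → Fin n → Fin n → Graph n
removeEdge G u v = record
  { adj    = overwrite u v false (adj G)
  ; sym    = λ x y → overwrite-sym {u = u} {v} {false} {adj G} (λ _ _ → ⊤)
                              (λ {x} {y} _ _ → Graph.sym G x y) {x} {y} tt
  ; irrefl = λ x → ≡.trans (overwrite-off-self x) (Graph.irrefl G x) }
  where
    overwrite-off-self : ∀ x → overwrite u v false (adj G) x x ≡ adj G x x
    overwrite-off-self x with pair? u v x x
    ... | yes _ = ≡.sym (Graph.irrefl G x)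
    ... | no _  = refl

module _ {n} (G : Graph n) (u v : Fin n) where
  removeEdge-⊆ : ∀ {x y} → Adj (removeEdge G u v) x y → Adj G x y
  removeEdge-⊆ {x} {y} xy with pair? u v x y
  ... | no _ = xy

  removeEdge-removes : ∀ {x y} → Adj (removeEdge G u v) x y → ¬ IsPair u v x y
  removeEdge-removes {x} {y} xy with pair? u v x y
  ... | no ¬p = ¬p

  removeEdge-keeps : ∀ {x y} → Adj G x y → ¬ IsPair u v x y → Adj (removeEdge G u v) x y
  removeEdge-keeps {x} {y} xy ¬p =
    subst T (≡.sym (overwrite-off {u = u} {v} {false} {adj G} {x} {y} ¬p)) xy

removeEdge-flip : ∀ {n} (G : Graph n) u v {x y} →
                  Adj (removeEdge G v u) x y → Adj (removeEdge G u v) x y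
removeEdge-flip G u v {x} {y} xy = removeEdge-keeps G u v (removeEdge-⊆ G v u {x} {y} xy)
  (λ p → removeEdge-removes G v u {x} {y} xy (pair-flip p))

module _ {n} (G : Graph n) (u v : Fin n) where
  degree-removeEdge : ∀ x → degree (removeEdge G u v) x ≤ degree G x
  degree-removeEdge x =
    count-mono (adj (removeEdge G u v) x) (adj G x) (λ y → removeEdge-⊆ G u v {x} {y}) (allFinL n)

  degree-removeEdge-< : ∀ {x y} → IsPair u v x y → Adj G x y → degree (removeEdge G u v) x < degree G x
  degree-removeEdge-< {x} {y} xy-uv xy =
    count-strict (adj (removeEdge G u v) x) (adj G x) (λ z → removeEdge-⊆ G u v {x} {z})
      (allFinL n) (∈-allFin y) xy (λ xy' → removeEdge-removes G u v {x} {y} xy' xy-uv)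

degreeSum : ∀ {n} → Graph n → ℕ
degreeSum {n} G = sum (map (degree G) (allFinL n))

degreeSum-removeEdge : ∀ {n} (G : Graph n) u v → Adj G u v → degreeSum (removeEdge G u v) < degreeSum G
degreeSum-removeEdge {n} G u v uv =
  sum-strict (degree (removeEdge G u v)) (degree G) (degree-removeEdge G u v) (allFinL n)
    (∈-allFin u) (degree-removeEdge-< G u v (inj₁ (refl , refl)) uv)

edge-induction : ∀ {n} (P : Graph n → Set) →
                 (∀ G → (∀ u v → Adj G u v → P (removeEdge G u v)) → P G) → ∀ G → P G
edge-induction P step =
  All.wfRec (On.wellFounded degreeSum <-wellFounded) 0ℓ P
    (λ G smaller → step G (λ u v uv → smaller (degreeSum-removeEdge G u v uv)))

record EdgeColouring {n} (G : Graph n) (k : ℕ) : Set where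
  field
    φ        : Fin n → Fin n → Fin k
    φ-sym    : ∀ x y → Adj G x y → φ x y ≡ φ y x
    φ-proper : ∀ x y z → Adj G x y → Adj G x z → y ≢ z → φ x y ≢ φ x z
open EdgeColouring

extend-edge : ∀ {n k} (G : Graph n) u v → let G′ = removeEdge G u v in
              (E : EdgeColouring G′ k) (p : Fin k) →
              (∀ y → Adj G′ u y → φ E u y ≢ p) → (∀ y → Adj G′ v y → φ E v y ≢ p) →
              EdgeColouring G k
extend-edge {n} {k} G u v E p u-misses v-misses = record
  { φ = ψ
  ; φ-sym = λ x y xy → overwrite-sym {u = u} {v} {p} {φ E} (Adj G)
                         (λ {x} {y} xy ¬p → φ-sym E x y (keep xy ¬p)) {x} {y} xy
  ; φ-proper = ψ-proper }
  where
    G′ : Graph n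
    G′ = removeEdge G u v
    keep : ∀ {x y} → Adj G x y → ¬ IsPair u v x y → Adj G′ x y
    keep = removeEdge-keeps G u v
    ψ : Fin n → Fin n → Fin k
    ψ = overwrite u v p (φ E)
    misses : ∀ x y z → IsPair u v x y → Adj G′ x z → φ E x z ≢ p
    misses _ _ z (inj₁ (refl , refl)) = u-misses z
    misses _ _ z (inj₂ (refl , refl)) = v-misses z
    ψ-proper : ∀ x y z → Adj G x y → Adj G x z → y ≢ z → ψ x y ≢ ψ x z
    ψ-proper x y z xy xz y≢z with pair? u v x y | pair? u v x z
    ... | yes p₁ | yes p₂ = contradiction (pair-unique p₁ p₂) y≢z
    ... | yes p₁ | no ¬p₂ = λ e → misses x y z p₁ (keep xz ¬p₂) (≡.sym e)
    ... | no ¬p₁ | yes p₂ = misses x z y p₂ (keep xy ¬p₁)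
    ... | no ¬p₁ | no ¬p₂ = φ-proper E x y z (keep xy ¬p₁) (keep xz ¬p₂) y≢z

Bipartite : ∀ {n} → (Fin n → Bool) → Graph n → Set
Bipartite Big G = ∀ x y → Adj G x y → Big y ≡ not (Big x)

opposite : ∀ {n} {Big : Fin n → Bool} (G : Graph n) → Bipartite Big G →
           ∀ x y → Adj G x y → ∀ {c} → Big x ≡ c → Big y ≡ not c
opposite G B x y xy x-class = ≡.trans (B x y xy) (≡.cong not x-class)

bipartite-removeEdge : ∀ {n} {Big : Fin n → Bool} (G : Graph n) u v →
                       Bipartite Big G → Bipartite Big (removeEdge G u v)
bipartite-removeEdge G u v B x y xy = B x y (removeEdge-⊆ G u v {x} {y} xy)

-- Follow from b the edges coloured c, β, c, β, ...; by properness
-- this walk is determined, never revisits a vertex, and so ends.  Swapping β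
-- and c on its edges gives an edge colouring in which b misses c, and in which
-- every non-Big vertex that missed c still misses c (the walk reaches non-Big
-- vertices only along c-edges).
module KempeSwap {n k} (G : Graph n) (E : EdgeColouring G k) (Big : Fin n → Bool)
  (bipartite : Bipartite Big G)
  (b : Fin n) (b-big : Big b ≡ true) (β c : Fin k) (c≢β : c ≢ β)
  (b-misses-β : ∀ y → Adj G b y → φ E b y ≢ β) where

  colour-determines : ∀ x y z → Adj G x y → Adj G x z → φ E x y ≡ φ E x z → y ≡ z
  colour-determines x y z xy xz e with y ≟ z
  ... | yes y≡z = y≡z
  ... | no y≢z  = contradiction e (φ-proper E x y z xy xz y≢z)

  next : Fin n → Fin k → Maybe (Fin n)
  next x γ with any? (λ y → T? (adj G x y) ×-dec (φ E x y ≟ γ))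
  ... | yes (y , _) = just y
  ... | no _        = nothing

  next-sound : ∀ x γ y → next x γ ≡ just y → Adj G x y × φ E x y ≡ γ
  next-sound x γ y eq with any? (λ y → T? (adj G x y) ×-dec (φ E x y ≟ γ))
  next-sound x γ y refl | yes (.y , found) = found

  next-complete : ∀ x γ y → Adj G x y → φ E x y ≡ γ → next x γ ≡ just y
  next-complete x γ y xy φ≡γ with any? (λ y → T? (adj G x y) ×-dec (φ E x y ≟ γ))
  ... | yes (y′ , xy′ , φ≡γ′) =
    ≡.cong just (colour-determines x y′ y xy′ xy (≡.trans φ≡γ′ (≡.sym φ≡γ)))
  ... | no none = contradiction (y , xy , φ≡γ) none

  even : ℕ → Bool
  even zero    = true
  even (suc i) = not (even i)

  stepColour : ℕ → Fin k
  stepColour i = if even i then c else β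

  walk : ℕ → Maybe (Fin n)
  walk zero    = just b
  walk (suc i) = walk i >>= λ x → next x (stepColour i)

  walk-step : ∀ i y → walk (suc i) ≡ just y →
              ∃ λ x → walk i ≡ just x × Adj G x y × φ E x y ≡ stepColour i
  walk-step i y eq with walk i
  ... | just x = x , refl , next-sound x (stepColour i) y eq

  walk-continues : ∀ i x y → walk i ≡ just x → Adj G x y → φ E x y ≡ stepColour i →
                   walk (suc i) ≡ just y
  walk-continues i x y eq xy φ≡ rewrite eq = next-complete x (stepColour i) y xy φ≡

  walk-parity : ∀ i x → walk i ≡ just x → Big x ≡ even i
  walk-parity zero    x refl = b-big
  walk-parity (suc i) y eq with walk-step i y eq
  ... | x , wx , xy , _ = ≡.trans (bipartite x y xy) (≡.cong not (walk-parity i x wx))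

  stepColour-odd : ∀ i → even i ≡ false → stepColour i ≡ β
  stepColour-odd i e rewrite e = refl

  stepColour-even : ∀ i → even i ≡ true → stepColour i ≡ c
  stepColour-even i e rewrite e = refl

  same-parity-same-colour : ∀ i j → not (even i) ≡ not (even j) → stepColour i ≡ stepColour j
  same-parity-same-colour i j e with even i | even j
  ... | true  | true  = refl
  ... | false | false = refl

  -- the walk never returns to b, since b misses β
  walk-leaves-b : ∀ j → walk (suc j) ≢ just b
  walk-leaves-b j eq with walk-step j b eq
  ... | x , _ , xb , φ≡ = b-misses-β x (Adj-sym G xb)
        (≡.trans (≡.sym (φ-sym E x b xb)) (≡.trans φ≡ (stepColour-odd j j-odd)))
    where
      j-odd : even j ≡ false
      j-odd with even j | walk-parity (suc j) b eq
      ... | false | _ = refl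
      ... | true  | b-small = contradiction (≡.trans (≡.sym b-big) b-small) λ ()

  -- the walk is a path: two steps before a common vertex would both enter it
  -- along the same colour, so by induction they coincide
  walk-injective : ∀ i j x → walk i ≡ just x → walk j ≡ just x → i ≡ j
  walk-injective zero    zero    _ _  _  = refl
  walk-injective zero    (suc j) _ refl wj = contradiction wj (walk-leaves-b j)
  walk-injective (suc i) zero    _ wi refl = contradiction wi (walk-leaves-b i)
  walk-injective (suc i) (suc j) y wi wj with walk-step i y wi | walk-step j y wj
  ... | p , wp , py , φp | q , wq , qy , φq =
    ≡.cong suc (walk-injective i j p wp (subst (λ r → walk j ≡ just r) (≡.sym p≡q) wq))
    where
      same-step : stepColour i ≡ stepColour j
      same-step = same-parity-same-colour i j (≡.trans (≡.sym (walk-parity (suc i) y wi)) (walk-parity (suc j) y wj))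
      p≡q : p ≡ q
      p≡q = colour-determines y p q (Adj-sym G py) (Adj-sym G qy)
              (≡.trans (≡.sym (φ-sym E p y py))
                (≡.trans φp (≡.trans same-step (≡.trans (≡.sym φq) (φ-sym E q y qy)))))

  Defined : ℕ → Set
  Defined i = ∃ λ x → walk i ≡ just x

  defined-before : ∀ {i j} → j ≤′ i → Defined i → Defined j
  defined-before (≤′-reflexive refl) d = d
  defined-before {suc i} (≤′-step j≤i) (y , wy) with walk-step i y wy
  ... | x , wx , _ = defined-before j≤i (x , wx)

  -- a walk without repetitions has fewer than n steps
  walk-bounded : ∀ i x → walk i ≡ just x → i < n
  walk-bounded i x wi = injective⇒≤ {f = vertexAt} vertexAt-injective
    where
      vertexAt : Fin (suc i) → Fin n
      vertexAt t = proj₁ (defined-before (≤⇒≤′ (≤-pred (toℕ<n t))) (x , wi))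
      vertexAt-spec : ∀ t → walk (toℕ t) ≡ just (vertexAt t)
      vertexAt-spec t = proj₂ (defined-before (≤⇒≤′ (≤-pred (toℕ<n t))) (x , wi))
      vertexAt-injective : ∀ {s t} → vertexAt s ≡ vertexAt t → s ≡ t
      vertexAt-injective {s} {t} e = toℕ-injective (walk-injective (toℕ s) (toℕ t) (vertexAt s)
        (vertexAt-spec s) (subst (λ r → walk (toℕ t) ≡ just r) (≡.sym e) (vertexAt-spec t)))

  -- xy is a step of the walk; by walk-bounded steps are indexed by Fin n,
  -- which makes the property decidable
  Step : Fin n → Fin n → Set
  Step x y = ∃ λ (t : Fin n) → walk (toℕ t) ≡ just x × walk (suc (toℕ t)) ≡ just y

  step? : ∀ x y → Dec (Step x y)
  step? x y = any? λ t → ≡-dec _≟_ (walk (toℕ t)) (just x)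
                  ×-dec ≡-dec _≟_ (walk (suc (toℕ t))) (just y)

  step-at : ∀ i x y → walk i ≡ just x → walk (suc i) ≡ just y → Step x y
  step-at i x y wi wsi = fromℕ< i<n , subst (λ j → walk j ≡ just x) (≡.sym at) wi
                                    , subst (λ j → walk (suc j) ≡ just y) (≡.sym at) wsi
    where
      i<n : i < n
      i<n = walk-bounded i x wi
      at : toℕ (fromℕ< i<n) ≡ i
      at = toℕ-fromℕ< i<n

  OnChain : Fin n → Fin n → Set
  OnChain x y = Step x y ⊎ Step y x

  onChain? : ∀ x y → Dec (OnChain x y)
  onChain? x y = step? x y ⊎-dec step? y x

  onChain-sym : ∀ {x y} → OnChain x y → OnChain y x
  onChain-sym (inj₁ s) = inj₂ s
  onChain-sym (inj₂ s) = inj₁ s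

  ChainColour : Fin k → Set
  ChainColour γ = γ ≡ β ⊎ γ ≡ c

  stepColour-chain : ∀ i → ChainColour (stepColour i)
  stepColour-chain i with even i
  ... | true  = inj₂ refl
  ... | false = inj₁ refl

  previous-colour : ∀ j {γ} → ChainColour γ → γ ≢ stepColour (suc j) → γ ≡ stepColour j
  previous-colour j γ∈ γ≢ with even j
  previous-colour j (inj₁ γ≡β) γ≢ | true  = contradiction γ≡β γ≢
  previous-colour j (inj₂ γ≡c) γ≢ | true  = γ≡c
  previous-colour j (inj₁ γ≡β) γ≢ | false = γ≡β
  previous-colour j (inj₂ γ≡c) γ≢ | false = contradiction γ≡c γ≢

  step-edge : ∀ {x y} → Step x y → Adj G x y × ChainColour (φ E x y)
  step-edge {x} {y} (t , wx , wy) with walk-step (toℕ t) y wy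
  ... | x′ , wx′ , x′y , φ≡ with just-injective (≡.trans (≡.sym wx′) wx)
  ... | refl = x′y , subst ChainColour (≡.sym φ≡) (stepColour-chain (toℕ t))

  chain-edge : ∀ {x y} → OnChain x y → Adj G x y × ChainColour (φ E x y)
  chain-edge (inj₁ s) = step-edge s
  chain-edge {x} {y} (inj₂ s) with step-edge s
  ... | yx , γ∈ = Adj-sym G yx , subst ChainColour (φ-sym E y x yx) γ∈

  chain-vertex : ∀ {x y} → OnChain x y → ∃ λ j → walk j ≡ just x
  chain-vertex (inj₁ (t , wx , _)) = toℕ t , wx
  chain-vertex (inj₂ (t , _ , wx)) = suc (toℕ t) , wx

  chain-closed : ∀ j x z → walk j ≡ just x → Adj G x z → ChainColour (φ E x z) → OnChain x z
  chain-closed j x z wx xz γ∈ with φ E x z ≟ stepColour j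
  ... | yes φ≡ = inj₁ (step-at j x z wx (walk-continues j x z wx xz φ≡))
  chain-closed zero x z refl xz (inj₁ φ≡β) | no _ = contradiction φ≡β (b-misses-β z xz)
  chain-closed zero x z refl xz (inj₂ φ≡c) | no φ≢ = contradiction φ≡c φ≢
  chain-closed (suc j) x z wx xz γ∈ | no φ≢ with walk-step j x wx
  ... | x′ , wx′ , x′x , φ≡ with colour-determines x x′ z (Adj-sym G x′x) xz
                                   (≡.trans (≡.sym (φ-sym E x′ x x′x))
                                     (≡.trans φ≡ (≡.sym (previous-colour j γ∈ φ≢))))
  ... | refl = inj₂ (step-at j x′ x wx′ wx)

  chain-branch : ∀ {x y z} → OnChain x y → Adj G x z → ChainColour (φ E x z) → OnChain x z
  chain-branch {x} {z = z} xy∈ = chain-closed (proj₁ (chain-vertex xy∈)) x z (proj₂ (chain-vertex xy∈))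

  small-entered-by-c : ∀ j x → walk j ≡ just x → Big x ≡ false → ∃ λ y → Adj G x y × φ E x y ≡ c
  small-entered-by-c zero x refl x-small = contradiction (≡.trans (≡.sym b-big) x-small) λ ()
  small-entered-by-c (suc j) x wx x-small with walk-step j x wx
  ... | x′ , _ , x′x , φ≡ = x′ , Adj-sym G x′x ,
        ≡.trans (≡.sym (φ-sym E x′ x x′x)) (≡.trans φ≡ (stepColour-even j j-even))
    where
      j-even : even j ≡ true
      j-even with even j | ≡.trans (≡.sym x-small) (walk-parity (suc j) x wx)
      ... | true | _ = refl

  swap : Fin k → Fin k
  swap = transpose β c

  swap-β : swap β ≡ c
  swap-β rewrite dec-true (β ≟ β) refl = refl

  swap-c : swap c ≡ β
  swap-c rewrite dec-false (c ≟ β) c≢β | dec-true (c ≟ c) refl = refl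

  swap-chain : ∀ {γ} → ChainColour γ → ChainColour (swap γ)
  swap-chain (inj₁ refl) = inj₂ swap-β
  swap-chain (inj₂ refl) = inj₁ swap-c

  swap-injective : ∀ {γ δ} → swap γ ≡ swap δ → γ ≡ δ
  swap-injective {γ} {δ} e = begin
    γ                         ≡⟨ transpose-inverse c β ⟨
    transpose c β (swap γ)    ≡⟨ ≡.cong (transpose c β) e ⟩
    transpose c β (swap δ)    ≡⟨ transpose-inverse c β ⟩
    δ                         ∎

  ψ : Fin n → Fin n → Fin k
  ψ x y with onChain? x y
  ... | yes _ = swap (φ E x y)
  ... | no  _ = φ E x y

  ψ-sym : ∀ x y → Adj G x y → ψ x y ≡ ψ y x
  ψ-sym x y xy with onChain? x y | onChain? y x
  ... | yes _   | yes _   = ≡.cong swap (φ-sym E x y xy)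
  ... | yes xy∈ | no ¬yx∈ = contradiction (onChain-sym xy∈) ¬yx∈
  ... | no ¬xy∈ | yes yx∈ = contradiction (onChain-sym yx∈) ¬xy∈
  ... | no _    | no _    = φ-sym E x y xy

  -- a swapped and an unswapped edge at x cannot clash: the swapped one carries
  -- a chain colour, and chain-coloured edges at chain vertices are on the chain
  ψ-proper : ∀ x y z → Adj G x y → Adj G x z → y ≢ z → ψ x y ≢ ψ x z
  ψ-proper x y z xy xz y≢z with onChain? x y | onChain? x z
  ... | yes _   | yes _   = λ e → φ-proper E x y z xy xz y≢z (swap-injective e)
  ... | no _    | no _    = φ-proper E x y z xy xz y≢z
  ... | yes xy∈ | no ¬xz∈ = λ e → ¬xz∈ (chain-branch xy∈ xz
                                 (subst ChainColour e (swap-chain (proj₂ (chain-edge xy∈)))))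
  ... | no ¬xy∈ | yes xz∈ = λ e → ¬xy∈ (chain-branch xz∈ xy
                                 (subst ChainColour (≡.sym e) (swap-chain (proj₂ (chain-edge xz∈)))))

  swapped : EdgeColouring G k
  swapped = record { φ = ψ ; φ-sym = ψ-sym ; φ-proper = ψ-proper }

  b-misses-c : ∀ y → Adj G b y → ψ b y ≢ c
  b-misses-c y by with onChain? b y
  ... | no ¬by∈ = λ φ≡c → ¬by∈ (chain-closed zero b y refl by (inj₂ φ≡c))
  ... | yes by∈ with proj₂ (chain-edge by∈)
  ...   | inj₁ φ≡β = contradiction φ≡β (b-misses-β y by)
  ...   | inj₂ φ≡c = λ e → c≢β (≡.trans (≡.sym e) (≡.trans (≡.cong swap φ≡c) swap-c))

  small-keeps-missing : ∀ u → Big u ≡ false → (∀ y → Adj G u y → φ E u y ≢ c) →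
                        ∀ y → Adj G u y → ψ u y ≢ c
  small-keeps-missing u u-small u-misses y uy with onChain? u y
  ... | no _    = u-misses y uy
  ... | yes uy∈ with chain-vertex uy∈
  ...   | j , wu with small-entered-by-c j u wu u-small
  ...     | y′ , uy′ , φ≡c = contradiction φ≡c (u-misses y′ uy′)

-- The local structure of a 2-sparse graph of maximum degree at most Δ, relative
-- to the set Big of its vertices of degree at least 3: Big vertices are pairwise
-- non-adjacent and the others have degree at most 2.  Subgraphs inherit it.
record Sparse {n} (Δ : ℕ) (Big : Fin n → Bool) (G : Graph n) : Set where
  field
    big-independent : ∀ x y → Adj G x y → Big x ≡ true → Big y ≡ false
    small-degree    : ∀ x → Big x ≡ false → degree G x ≤ 2
    max-degree      : ∀ x → degree G x ≤ Δ
open Sparse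

sparse-removeEdge : ∀ {n Δ Big} (G : Graph n) u v → Sparse Δ Big G → Sparse Δ Big (removeEdge G u v)
sparse-removeEdge G u v S = record
  { big-independent = λ x y xy → big-independent S x y (removeEdge-⊆ G u v {x} {y} xy)
  ; small-degree    = λ x x-small → ≤-trans (degree-removeEdge G u v x) (small-degree S x x-small)
  ; max-degree      = λ x → ≤-trans (degree-removeEdge G u v x) (max-degree S x) }

-- Edges are
-- added one at a time; a Kempe swap at the Big endpoint makes room when the two
-- endpoints miss different colours.  (0 < Δ only serves to colour edgeless graphs.)
bipartite-edge-colouring : ∀ {n Δ} (Big : Fin n → Bool) → 0 < Δ → (G : Graph n) →
                           Sparse Δ Big G → Bipartite Big G → EdgeColouring G Δ
bipartite-edge-colouring {n} {Δ} Big 0<Δ = edge-induction P step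
  where
    P : Graph n → Set
    P G = Sparse Δ Big G → Bipartite Big G → EdgeColouring G Δ

    insert : ∀ G u b → Adj G u b → Big u ≡ false → Big b ≡ true →
             Sparse Δ Big G → Bipartite Big G → EdgeColouring (removeEdge G u b) Δ → EdgeColouring G Δ
    insert G u b ub u-small b-big S B E
      with missing-colour G′ b (φ E b) (below b (inj₂ (refl , refl)) (Adj-sym G ub))
         | missing-colour G′ u (φ E u) (below u (inj₁ (refl , refl)) ub)
      where
        G′ : Graph n
        G′ = removeEdge G u b
        below : ∀ x {y} → IsPair u b x y → Adj G x y → degree G′ x < Δ
        below x xy-ub xy = ≤-trans (degree-removeEdge-< G u b xy-ub xy) (max-degree S x)
    ... | γ , b-misses-γ | c , u-misses-c with c ≟ γ
    ...   | yes refl = extend-edge G u b E c u-misses-c b-misses-γ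
    ...   | no c≢γ   = extend-edge G u b swapped c (small-keeps-missing u u-small u-misses-c) b-misses-c
      where
        open KempeSwap (removeEdge G u b) E Big (bipartite-removeEdge G u b B) b b-big γ c c≢γ b-misses-γ

    step : ∀ G → (∀ u v → Adj G u v → P (removeEdge G u v)) → P G
    step G smaller S B with any? (λ x → any? (λ y → T? (adj G x y)))
    ... | no edgeless = record
      { φ = λ _ _ → fromℕ< 0<Δ
      ; φ-sym = λ x y xy → contradiction (x , y , xy) edgeless
      ; φ-proper = λ x y _ xy → contradiction (x , y , xy) edgeless }
    ... | yes (x , y , xy) with true-or-false (Big x)
    ...   | inj₁ x-big   = insert G y x (Adj-sym G xy) (opposite G B x y xy x-big) x-big S B
                             (smaller y x (Adj-sym G xy) (sparse-removeEdge G y x S) (bipartite-removeEdge G y x B))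
    ...   | inj₂ x-small = insert G x y xy x-small (opposite G B x y xy x-small) S B
                             (smaller x y xy (sparse-removeEdge G x y S) (bipartite-removeEdge G x y B))

-- The anchoring is what rules out, when re-inserting an edge
-- between non-Big vertices, that both obstructing neighbours are Big.
record AnchoredColouring {n} (G : Graph n) (k : ℕ) (Big : Fin n → Bool) : Set where
  field
    vc        : Fin n → Fin (suc k)
    edges     : EdgeColouring G (suc k)
    vv-proper : ∀ x y → Adj G x y → vc x ≢ vc y
    ve-proper : ∀ x y → Adj G x y → φ edges x y ≢ vc x
    big-zero  : ∀ x → Big x ≡ true → vc x ≡ zero
open AnchoredColouring

ec : ∀ {n k Big} {G : Graph n} → AnchoredColouring G k Big → Fin n → Fin n → Fin (suc k)
ec C = φ (edges C)

restrict : ∀ {n k Big} {G H : Graph n} → (∀ {x y} → Adj H x y → Adj G x y) →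
           AnchoredColouring G k Big → AnchoredColouring H k Big
restrict H⊆G C = record
  { vc = vc C
  ; edges = record { φ = ec C ; φ-sym = λ x y xy → φ-sym (edges C) x y (H⊆G xy)
                   ; φ-proper = λ x y z xy xz → φ-proper (edges C) x y z (H⊆G xy) (H⊆G xz) }
  ; vv-proper = λ x y xy → vv-proper C x y (H⊆G xy)
  ; ve-proper = λ x y xy → ve-proper C x y (H⊆G xy)
  ; big-zero = big-zero C }

recolour-vertex : ∀ {n k Big} {G : Graph n} (C : AnchoredColouring G k Big) x (a : Fin (suc k)) →
                  Big x ≡ false → (∀ y → Adj G x y → vc C y ≢ a) → (∀ y → Adj G x y → ec C x y ≢ a) →
                  AnchoredColouring G k Big
recolour-vertex {n} {k} {Big} {G} C x a x-small nbrs-avoid edges-avoid = record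
  { vc = vc′ ; edges = edges C ; vv-proper = vv′ ; ve-proper = ve′ ; big-zero = zero′ }
  where
    vc′ : Fin n → Fin (suc k)
    vc′ = updateAt (vc C) x (λ _ → a)
    at-x : vc′ x ≡ a
    at-x = updateAt-updates x (vc C)
    off-x : ∀ {y} → y ≢ x → vc′ y ≡ vc C y
    off-x {y} y≢x = updateAt-minimal y x (vc C) y≢x
    vv′ : ∀ y z → Adj G y z → vc′ y ≢ vc′ z
    vv′ y z yz with y ≟ x | z ≟ x
    ... | yes refl | yes refl = contradiction refl (Adj⇒≢ G yz)
    ... | yes refl | no z≢x = λ e → nbrs-avoid z yz (≡.trans (≡.sym (off-x z≢x)) (≡.trans (≡.sym e) at-x))
    ... | no y≢x | yes refl = λ e → nbrs-avoid y (Adj-sym G yz) (≡.trans (≡.sym (off-x y≢x)) (≡.trans e at-x))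
    ... | no y≢x | no z≢x = λ e → vv-proper C y z yz (≡.trans (≡.sym (off-x y≢x)) (≡.trans e (off-x z≢x)))
    ve′ : ∀ y z → Adj G y z → ec C y z ≢ vc′ y
    ve′ y z yz with y ≟ x
    ... | yes refl = λ e → edges-avoid z yz (≡.trans e at-x)
    ... | no y≢x = λ e → ve-proper C y z yz (≡.trans e (off-x y≢x))
    zero′ : ∀ y → Big y ≡ true → vc′ y ≡ zero
    zero′ y y-big with y ≟ x
    ... | yes refl = contradiction (≡.trans (≡.sym y-big) x-small) λ ()
    ... | no y≢x = ≡.trans (off-x y≢x) (big-zero C y y-big)

insert-edge : ∀ {n k Big} (G : Graph n) u v → let G′ = removeEdge G u v in
              (C : AnchoredColouring G′ k Big) (p : Fin (suc k)) →
              vc C u ≢ vc C v → p ≢ vc C u → p ≢ vc C v →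
              (∀ y → Adj G′ u y → ec C u y ≢ p) → (∀ y → Adj G′ v y → ec C v y ≢ p) →
              AnchoredColouring G k Big
insert-edge G u v C p u≢v p≢u p≢v u-misses v-misses = record
  { vc = vc C ; edges = extend-edge G u v (edges C) p u-misses v-misses
  ; vv-proper = vv′ ; ve-proper = ve′ ; big-zero = big-zero C }
  where
    keep : ∀ {x y} → Adj G x y → ¬ IsPair u v x y → Adj (removeEdge G u v) x y
    keep = removeEdge-keeps G u v
    vv′ : ∀ x y → Adj G x y → vc C x ≢ vc C y
    vv′ x y xy with pair? u v x y
    ... | yes (inj₁ (refl , refl)) = u≢v
    ... | yes (inj₂ (refl , refl)) = λ e → u≢v (≡.sym e)
    ... | no ¬p = vv-proper C x y (keep xy ¬p)
    ve′ : ∀ x y → Adj G x y → overwrite u v p (ec C) x y ≢ vc C x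
    ve′ x y xy with pair? u v x y
    ... | yes (inj₁ (refl , refl)) = p≢u
    ... | yes (inj₂ (refl , refl)) = p≢v
    ... | no ¬p = ve-proper C x y (keep xy ¬p)

recolour-edge : ∀ {n k Big} {G : Graph n} (C : AnchoredColouring G k Big) u v → Adj G u v →
                (q : Fin (suc k)) → q ≢ vc C u → q ≢ vc C v →
                (∀ z → Adj G u z → z ≢ v → ec C u z ≢ q) → (∀ z → Adj G v z → z ≢ u → ec C v z ≢ q) →
                AnchoredColouring G k Big
recolour-edge {G = G} C u v uv q q≢u q≢v u-misses v-misses =
  insert-edge G u v (restrict (λ {x} {y} → removeEdge-⊆ G u v {x} {y}) C) q (vv-proper C u v uv) q≢u q≢v
    (λ z uz → u-misses z (removeEdge-⊆ G u v {u} {z} uz)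
                (λ { refl → removeEdge-removes G u v {u} {z} uz (inj₁ (refl , refl)) }))
    (λ z vz → v-misses z (removeEdge-⊆ G u v {v} {z} vz)
                (λ { refl → removeEdge-removes G u v {v} {z} vz (inj₂ (refl , refl)) }))

-- A bipartite graph as above, with Δ ≥ 3, has an anchored (Δ+1)-total-colouring:
-- Big vertices get colour 0, edges the colours 1 … Δ of a Δ-edge-colouring, and
-- each other vertex, seeing 0 and at most two edge colours, a fourth colour.
bipartite-total-colouring : ∀ {n Δ} (Big : Fin n → Bool) → 3 ≤ Δ → (G : Graph n) →
                            Sparse Δ Big G → Bipartite Big G → AnchoredColouring G Δ Big
bipartite-total-colouring {n} {Δ} Big 3≤Δ G S B = record
  { vc = vc′
  ; edges = record { φ = ψ ; φ-sym = λ x y xy → ≡.cong suc (φ-sym E x y xy)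
                   ; φ-proper = λ x y z xy xz y≢z e → φ-proper E x y z xy xz y≢z (suc-injective e) }
  ; vv-proper = vv′ ; ve-proper = ve′ ; big-zero = zero′ }
  where
    E : EdgeColouring G Δ
    E = bipartite-edge-colouring Big (≤-trans (s≤s z≤n) 3≤Δ) G S B
    ψ : Fin n → Fin n → Fin (suc Δ)
    ψ x y = suc (φ E x y)
    small-colour : ∀ x → Big x ≡ false → ∃ λ γ → γ ∉ zero ∷ [] × (∀ y → Adj G x y → ψ x y ≢ γ)
    small-colour x x-small =
      fresh-at G x (ψ x) (zero ∷ []) (s≤s (≤-trans (s≤s (small-degree S x x-small)) 3≤Δ))
    colour-by : ∀ x b → Big x ≡ b → Fin (suc Δ)
    colour-by x true  _       = zero
    colour-by x false x-small = proj₁ (small-colour x x-small)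
    vc′ : Fin n → Fin (suc Δ)
    vc′ x = colour-by x (Big x) refl
    zero-by : ∀ x b (e : Big x ≡ b) → b ≡ true → colour-by x b e ≡ zero
    zero-by x true _ _ = refl
    small-by : ∀ x b (e : Big x ≡ b) → b ≡ false →
               colour-by x b e ≢ zero × (∀ y → Adj G x y → ψ x y ≢ colour-by x b e)
    small-by x false x-small _ =
      (λ e → proj₁ (proj₂ (small-colour x x-small)) (here e)) , proj₂ (proj₂ (small-colour x x-small))
    zero′ : ∀ x → Big x ≡ true → vc′ x ≡ zero
    zero′ x = zero-by x (Big x) refl
    small′ : ∀ x → Big x ≡ false → vc′ x ≢ zero × (∀ y → Adj G x y → ψ x y ≢ vc′ x)
    small′ x = small-by x (Big x) refl
    vv′ : ∀ x y → Adj G x y → vc′ x ≢ vc′ y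
    vv′ x y xy with true-or-false (Big x)
    ... | inj₁ x-big   = λ e → proj₁ (small′ y (opposite G B x y xy x-big))
                                      (≡.trans (≡.sym e) (zero′ x x-big))
    ... | inj₂ x-small = λ e → proj₁ (small′ x x-small) (≡.trans e (zero′ y (opposite G B x y xy x-small)))
    ve′ : ∀ x y → Adj G x y → ψ x y ≢ vc′ x
    ve′ x y xy with true-or-false (Big x)
    ... | inj₁ x-big   = λ e → contradiction (≡.trans e (zero′ x x-big)) λ ()
    ... | inj₂ x-small = proj₂ (small′ x x-small) y xy

data AtMostOneNeighbour {n} (H : Graph n) (x : Fin n) : Set where
  isolated : (∀ y → ¬ Adj H x y) → AtMostOneNeighbour H x
  single   : ∀ x′ → Adj H x x′ → (∀ y → Adj H x y → y ≡ x′) → AtMostOneNeighbour H x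

at-most-one-neighbour : ∀ {n} (H : Graph n) x → degree H x ≤ 1 → AtMostOneNeighbour H x
at-most-one-neighbour H x deg≤1 with any? (λ y → T? (adj H x y))
... | no none = isolated (λ y xy → none (y , xy))
... | yes (x′ , xx′) =
  single x′ xx′ (λ y xy → at-most-one deg≤1 (∈-neighbours H xy) (∈-neighbours H xx′))

transport-neighbour : ∀ {n} {H K : Graph n} {x} → (∀ y → Adj H x y → Adj K x y) →
                      (∀ y → Adj K x y → Adj H x y) → AtMostOneNeighbour H x → AtMostOneNeighbour K x
transport-neighbour H⇒K K⇒H (isolated none) = isolated (λ y xy → none y (K⇒H y xy))
transport-neighbour H⇒K K⇒H (single x′ xx′ unique) =
  single x′ (H⇒K x′ xx′) (λ y xy → unique y (K⇒H y xy))

-- In G − uv both u and v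
-- have at most one neighbour, u′ and v′; write a₁, a₂ for the colours of u′ and
-- of uu′, and b₁, b₂ for those of v′ and vv′.  If b₁ ≢ a₂, give uv the colour b₁
-- and recolour u and v with colours avoiding what they see (finish).  This
-- covers everything up to exchanging u and v, except b₁ ≡ a₂ and a₁ ≡ b₂; then
-- one of u′, v′ is not Big, say u′, and recolouring uu′ restores b₁ ≢ a₂.
module InsertSmallEdge {n Δ} {Big : Fin n → Bool} (3≤Δ : 3 ≤ Δ) (G : Graph n) (S : Sparse Δ Big G)
                       (u v : Fin n) (uv : Adj G u v) (u-small : Big u ≡ false) (v-small : Big v ≡ false) where
  G′ : Graph n
  G′ = removeEdge G u v

  Colouring : Set
  Colouring = AnchoredColouring G′ Δ Big

  3<1+Δ : 3 < suc Δ
  3<1+Δ = s≤s 3≤Δ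

  u-not-neighbour : ∀ {y} → Adj G′ v y → y ≢ u
  u-not-neighbour {y} vy refl = removeEdge-removes G u v {v} {y} vy (inj₂ (refl , refl))

  Sees : Colouring → Fin n → Fin (suc Δ) → Fin (suc Δ) → Set
  Sees C x c₁ c₂ = ∀ y → Adj G′ x y → vc C y ≡ c₁ × ec C x y ≡ c₂

  sees-single : (C : Colouring) {x : Fin n} (x′ : Fin n) → (∀ y → Adj G′ x y → y ≡ x′) →
                Sees C x (vc C x′) (ec C x x′)
  sees-single C {x} x′ unique y xy with unique y xy
  ... | refl = refl , refl

  edge≢end : (C : Colouring) {x x′ : Fin n} → Adj G′ x x′ → vc C x′ ≢ ec C x x′
  edge≢end C {x} {x′} xx′ e =
    ve-proper C x′ x (Adj-sym G′ {x} {x′} xx′) (≡.trans (≡.sym (φ-sym (edges C) x x′ xx′)) (≡.sym e))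

  finish : (C : Colouring) (a₁ a₂ b₁ b₂ : Fin (suc Δ)) → Sees C u a₁ a₂ → Sees C v b₁ b₂ →
           b₁ ≢ a₂ → b₁ ≢ b₂ → AnchoredColouring G Δ Big
  finish C a₁ a₂ b₁ b₂ sees-u sees-v b₁≢a₂ b₁≢b₂ with three-avoiding 3<1+Δ a₁ a₂ b₁
  ... | a , a≢a₁ , a≢a₂ , a≢b₁ with three-avoiding 3<1+Δ b₁ b₂ a
  ... | b , b≢b₁ , b≢b₂ , b≢a =
    insert-edge G u v C₂ b₁ (λ e → b≢a (≡.sym (≡.trans (≡.sym u↦a) (≡.trans e v↦b))))
      (λ e → a≢b₁ (≡.sym (≡.trans e u↦a))) (λ e → b≢b₁ (≡.sym (≡.trans e v↦b)))
      (λ y uy e → b₁≢a₂ (≡.sym (≡.trans (≡.sym (proj₂ (sees-u y uy))) e)))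
      (λ y vy e → b₁≢b₂ (≡.sym (≡.trans (≡.sym (proj₂ (sees-v y vy))) e)))
    where
      C₁ C₂ : AnchoredColouring G′ Δ Big
      C₁ = recolour-vertex C u a u-small
             (λ y uy e → a≢a₁ (≡.trans (≡.sym e) (proj₁ (sees-u y uy))))
             (λ y uy e → a≢a₂ (≡.trans (≡.sym e) (proj₂ (sees-u y uy))))
      C₂ = recolour-vertex C₁ v b v-small
             (λ y vy e → b≢b₁ (≡.trans (≡.sym e)
                (≡.trans (updateAt-minimal y u (vc C) (u-not-neighbour vy)) (proj₁ (sees-v y vy)))))
             (λ y vy e → b≢b₂ (≡.trans (≡.sym e) (proj₂ (sees-v y vy))))
      u↦a : vc C₂ u ≡ a
      u↦a = ≡.trans (updateAt-minimal u v (vc C₁) (Adj⇒≢ G uv)) (updateAt-updates u (vc C))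
      v↦b : vc C₂ v ≡ b
      v↦b = updateAt-updates v (vc C₁)

  seen-pair : (C : Colouring) (x : Fin n) → AtMostOneNeighbour G′ x →
              ∃ λ c₁ → ∃ λ c₂ → Sees C x c₁ c₂ × c₁ ≢ c₂
  seen-pair C x (isolated none) with three-avoiding 3<1+Δ zero zero zero
  ... | c , c≢0 , _ = zero , c , (λ y xy → contradiction xy (none y)) , (λ e → c≢0 (≡.sym e))
  seen-pair C x (single x′ xx′ unique) = vc C x′ , ec C x x′ , sees-single C x′ unique , edge≢end C xx′

  -- if u has no neighbour, any colours count as seen from u
  finish-isolated : (C : Colouring) → (∀ y → ¬ Adj G′ u y) → AtMostOneNeighbour G′ v →
                    AnchoredColouring G Δ Big
  finish-isolated C none v-nbhd with seen-pair C v v-nbhd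
  ... | b₁ , b₂ , sees-v , b₁≢b₂ =
    finish C b₂ b₂ b₁ b₂ (λ y uy → contradiction uy (none y)) sees-v b₁≢b₂ b₁≢b₂

  finish-single : (C : Colouring) (u′ : Fin n) → (∀ y → Adj G′ u y → y ≡ u′) →
                  (v′ : Fin n) → Adj G′ v v′ → (∀ y → Adj G′ v y → y ≡ v′) →
                  vc C v′ ≢ ec C u u′ → AnchoredColouring G Δ Big
  finish-single C u′ u-unique v′ vv′ v-unique mismatch =
    finish C (vc C u′) (ec C u u′) (vc C v′) (ec C v v′)
      (sees-single C u′ u-unique) (sees-single C v′ v-unique) mismatch (edge≢end C vv′)

  repair : (C : Colouring) (u′ : Fin n) → Adj G′ u u′ → (∀ y → Adj G′ u y → y ≡ u′) →
           (v′ : Fin n) → Adj G′ v v′ → (∀ y → Adj G′ v y → y ≡ v′) →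
           vc C v′ ≡ ec C u u′ → Big u′ ≡ false → AnchoredColouring G Δ Big
  repair C u′ uu′ u-unique v′ vv′ v-unique b₁≡a₂ u′-small
    with fresh-at G′ u′ (ec C u′) (vc C u′ ∷ []) (s≤s (≤-trans (s≤s u′-degree) 3≤Δ))
    where u′-degree = small-degree (sparse-removeEdge G u v S) u′ u′-small
  ... | q , q∉ , q-new-at-u′ with three-avoiding 3<1+Δ (vc C u′) (ec C u u′) q
  ... | a , a≢a₁ , a≢a₂ , a≢q = finish-single C₂ u′ u-unique v′ vv′ v-unique mismatch
    where
      u′≢u : u′ ≢ u
      u′≢u e = Adj⇒≢ G′ uu′ (≡.sym e)
      C₁ C₂ : AnchoredColouring G′ Δ Big
      C₁ = recolour-vertex C u a u-small
             (λ y uy e → a≢a₁ (≡.trans (≡.sym e) (≡.cong (vc C) (u-unique y uy))))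
             (λ y uy e → a≢a₂ (≡.trans (≡.sym e) (≡.cong (ec C u) (u-unique y uy))))
      C₂ = recolour-edge C₁ u u′ uu′ q
             (λ e → a≢q (≡.sym (≡.trans e (updateAt-updates u (vc C)))))
             (λ e → q∉ (here (≡.trans e (updateAt-minimal u′ u (vc C) u′≢u))))
             (λ z uz z≢u′ → contradiction (u-unique z uz) z≢u′)
             (λ z u′z _ → q-new-at-u′ z u′z)
      a₂≢q : ec C u u′ ≢ q
      a₂≢q e = q-new-at-u′ u (Adj-sym G′ {u} {u′} uu′) (≡.trans (≡.sym (φ-sym (edges C) u u′ uu′)) e)
      mismatch : vc C₂ v′ ≢ ec C₂ u u′
      mismatch e = a₂≢q (begin
        ec C u u′          ≡⟨ b₁≡a₂ ⟨
        vc C v′            ≡⟨ updateAt-minimal v′ u (vc C) (u-not-neighbour vv′) ⟨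
        vc C₂ v′           ≡⟨ e ⟩
        ec C₂ u u′         ≡⟨ overwrite-on {u = u} {u′} {q} {ec C₁} {u} {u′} (inj₁ (refl , refl)) ⟩
        q                  ∎)

-- Re-inserting uv into a colouring of G − uv; the cases not covered by
-- InsertSmallEdge for (u , v) are covered by it for (v , u).
module _ {n Δ} {Big : Fin n → Bool} (3≤Δ : 3 ≤ Δ) (G : Graph n) (S : Sparse Δ Big G)
         (u v : Fin n) (uv : Adj G u v) (u-small : Big u ≡ false) (v-small : Big v ≡ false) where
  private
    module UV = InsertSmallEdge 3≤Δ G S u v uv u-small v-small
    module VU = InsertSmallEdge 3≤Δ G S v u (Adj-sym G uv) v-small u-small
    G′ : Graph n
    G′ = removeEdge G u v
    flip : ∀ x y → Adj (removeEdge G v u) x y → Adj G′ x y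
    flip x y = removeEdge-flip G u v {x} {y}
    flip˘ : ∀ x y → Adj G′ x y → Adj (removeEdge G v u) x y
    flip˘ x y = removeEdge-flip G v u {x} {y}
    degree≤1 : ∀ x {y} → IsPair u v x y → Adj G x y → Big x ≡ false → degree G′ x ≤ 1
    degree≤1 x xy-uv xy x-small =
      ≤-pred (≤-trans (degree-removeEdge-< G u v xy-uv xy) (small-degree S x x-small))

  insert-small-edge : AnchoredColouring G′ Δ Big → AnchoredColouring G Δ Big
  insert-small-edge C
    with at-most-one-neighbour G′ u (degree≤1 u (inj₁ (refl , refl)) uv u-small)
       | at-most-one-neighbour G′ v (degree≤1 v (inj₂ (refl , refl)) (Adj-sym G uv) v-small)
  ... | isolated none | v-nbhd = UV.finish-isolated C none v-nbhd
  ... | u-nbhd | isolated none =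
    VU.finish-isolated C˘ (λ y vy → none y (flip v y vy)) (transport-neighbour (flip˘ u) (flip u) u-nbhd)
    where C˘ : AnchoredColouring (removeEdge G v u) Δ Big
          C˘ = restrict (λ {x} {y} → flip x y) C
  ... | single u′ uu′ u-unique | single v′ vv′ v-unique with vc C v′ ≟ ec C u u′ | vc C u′ ≟ ec C v v′
  ...   | no b₁≢a₂ | _ = UV.finish-single C u′ u-unique v′ vv′ v-unique b₁≢a₂
  ...   | yes _ | no a₁≢b₂ =
    VU.finish-single C˘ v′ (λ y vy → v-unique y (flip v y vy))
      u′ (flip˘ u u′ uu′) (λ y uy → u-unique y (flip u y uy)) a₁≢b₂
    where C˘ : AnchoredColouring (removeEdge G v u) Δ Big
          C˘ = restrict (λ {x} {y} → flip x y) C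
  ...   | yes b₁≡a₂ | yes a₁≡b₂ with true-or-false (Big u′)
  ...     | inj₂ u′-small = UV.repair C u′ uu′ u-unique v′ vv′ v-unique b₁≡a₂ u′-small
  ...     | inj₁ u′-big =
    VU.repair C˘ v′ (flip˘ v v′ vv′) (λ y vy → v-unique y (flip v y vy))
      u′ (flip˘ u u′ uu′) (λ y uy → u-unique y (flip u y uy)) a₁≡b₂ v′-small
    where
      C˘ : AnchoredColouring (removeEdge G v u) Δ Big
      C˘ = restrict (λ {x} {y} → flip x y) C
      -- u′ and v′ are not both Big: otherwise a₂ ≡ b₁ ≡ 0 ≡ a₁
      v′-small : Big v′ ≡ false
      v′-small with true-or-false (Big v′)
      ... | inj₂ small = small
      ... | inj₁ big =
        contradiction (≡.trans (≡.trans (big-zero C u′ u′-big) (≡.sym (big-zero C v′ big))) b₁≡a₂)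
                         (UV.edge≢end C uu′)

sparse-total-colouring : ∀ {n Δ} (Big : Fin n → Bool) → 3 ≤ Δ → (G : Graph n) →
                         Sparse Δ Big G → AnchoredColouring G Δ Big
sparse-total-colouring {n} {Δ} Big 3≤Δ = edge-induction P step
  where
    P : Graph n → Set
    P G = Sparse Δ Big G → AnchoredColouring G Δ Big
    step : ∀ G → (∀ u v → Adj G u v → P (removeEdge G u v)) → P G
    small-edge? : ∀ G → Dec (∃ λ u → ∃ λ v → Adj G u v × Big u ≡ false × Big v ≡ false)
    small-edge? G = any? λ u → any? λ v →
      T? (adj G u v) ×-dec (Big u Bool.≟ false) ×-dec (Big v Bool.≟ false)
    step G smaller S with small-edge? G
    ... | yes (u , v , uv , u-small , v-small) =
      insert-small-edge 3≤Δ G S u v uv u-small v-small (smaller u v uv (sparse-removeEdge G u v S))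
    ... | no none = bipartite-total-colouring Big 3≤Δ G S bipartite
      where
        bipartite : Bipartite Big G
        bipartite x y xy with true-or-false (Big x) | true-or-false (Big y)
        ... | inj₁ x-big   | _            rewrite x-big = big-independent S x y xy x-big
        ... | inj₂ x-small | inj₁ y-big   rewrite x-small = y-big
        ... | inj₂ x-small | inj₂ y-small = contradiction (x , y , xy , x-small , y-small) none

total : ∀ {n k Big} {G : Graph n} → AnchoredColouring G k Big → TotalColouring G (suc k)
total C = record
  { vcol = vc C ; ecol = λ x y _ → ec C x y ; ecol-sym = λ x y xy _ → φ-sym (edges C) x y xy
  ; vv = vv-proper C ; ve = ve-proper C ; ee = φ-proper (edges C) }

two-sparse-structure : ∀ {n} (G : Graph n) Δ → TwoSparse G → (∀ v → degree G v ≤ Δ) →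
                       Sparse Δ (λ x → does (3 ≤? degree G x)) G
two-sparse-structure G Δ two-sparse max-degree = record
  { big-independent = independent ; small-degree = small ; max-degree = max-degree }
  where
    yes-witness : ∀ {d} (3≤?d : Dec (3 ≤ d)) → does 3≤?d ≡ true → 3 ≤ d
    yes-witness (yes 3≤d) _ = 3≤d
    no-witness : ∀ {d} (3≤?d : Dec (3 ≤ d)) → does 3≤?d ≡ false → d ≤ 2
    no-witness (no 3≰d) _ = ≤-pred (≰⇒> 3≰d)
    big : ∀ x → does (3 ≤? degree G x) ≡ true → 3 ≤ degree G x
    big x = yes-witness (3 ≤? degree G x)
    small : ∀ x → does (3 ≤? degree G x) ≡ false → degree G x ≤ 2
    small x = no-witness (3 ≤? degree G x)
    independent : ∀ x y → Adj G x y → does (3 ≤? degree G x) ≡ true → does (3 ≤? degree G y) ≡ false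
    independent x y xy x-big with true-or-false (does (3 ≤? degree G y)) | two-sparse x y xy
    ... | inj₂ y-small | _        = y-small
    ... | inj₁ y-big   | inj₁ x≤2 = contradiction (≤-trans (big x x-big) x≤2) λ { (s≤s (s≤s ())) }
    ... | inj₁ y-big   | inj₂ y≤2 = contradiction (≤-trans (big y y-big) y≤2) λ { (s≤s (s≤s ())) }

lemma12 : ∀ {n} (G : Graph n) (Δ : ℕ) → TwoSparse G → MaxDegree G Δ → 3 ≤ Δ →
          TotalColourable G (suc Δ)
lemma12 G Δ two-sparse (degree≤Δ , _) 3≤Δ = total (sparse-total-colouring Big 3≤Δ G structure)
  where
    Big : Fin _ → Bool
    Big x = does (3 ≤? degree G x)
    structure : Sparse Δ Big G
    structure = two-sparse-structure G Δ two-sparse degree≤Δ
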